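{- Let $n\geq k\geq 2$ and $r\geq 2$ be integers. Then $U(n,k,r)\leq \frac{n}{k}\, W(n-1,k-1,r-1)$.
   Context: For a positive integer $m$, $[m]=\{1,2,\ldots,m\}$, and for a set $Y$, $Y^{(j)}$ denotes the family of all $j$-element subsets of $Y$. The trace of a family $\mathcal{A}$ of sets on a set $X$ is $\mathcal{A}|_X=\{A\cap X: A\in\mathcal{A}\}$. For a set $X$ with $|X|=r$, a maximal chain of $X$ is a family $\{X_0, X_1,\ldots,X_r\}$ of subsets of $X$ with $X_0\subset X_1\subset\cdots\subset X_r=X$ and $|X_i|=i$ for all $i$; an almost maximal chain of $X$ is a family $\{X_1,\ldots,X_r\}$ of subsets of $X$ with $X_1\subset X_2\subset\cdots\subset X_r=X$ and $|X_i|=i$ for all $i$ (a maximal chain without the empty set). A trace $\mathcal{A}|_X$ contains a (almost) maximal chain of $X$ if every member of that chain belongs to $\mathcal{A}|_X$. For $n\geq k$ and $r\geq 1$, $W(n,k,r)$ is the maximum size of a family $\mathcal{A}\subseteq [n]^{(k)}$ such that for every $r$-subset $X$ of $[n]$ the trace $\mathcal{A}|_X$ does not contain a maximal chain of $X$. For $n\geq k$ and $r\geq 2$, $U(n,k,r)$ is the maximum size of a family $\mathcal{A}\subseteq [n]^{(k)}$ such that for every $r$-subset $X$ of $[n]$ the trace $\mathcal{A}|_X$ does not contain an almost maximal chain of $X$. -}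

module Defs where

open import Data.Nat using (ℕ; zero; suc; _≤_; _<_)
open import Data.Fin.Subset using (Subset; ∣_∣; _∩_; _⊆_)
open import Data.List using (List; length)
open import Data.List.Relation.Unary.All using (All)
open import Data.List.Relation.Unary.Unique.Propositional using (Unique)
open import Data.List.Membership.Propositional renaming (_∈_ to _∈ₗ_)
open import Data.Product using (Σ; _×_; ∃-syntax)
open import Relation.Binary.PropositionalEquality using (_≡_)
open import Relation.Nullary using (¬_)

-- A family of subsets of [n] is a duplicate-free list of subsets of Fin n;
-- its size is the length of the list.

InTrace : {n : ℕ} → List (Subset n) → Subset n → Subset n → Set
InTrace F X Y = ∃[ A ] (A ∈ₗ F × A ∩ X ≡ Y)

-- The trace F|_X (with |X| = r) contains a chain X_lo ⊂ X_(lo+1) ⊂ ... ⊂ X_r = X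
-- with |X_i| = i.  lo = 0 : maximal chain;  lo = 1 : almost maximal chain.
TraceHasChain : {n : ℕ} → ℕ → List (Subset n) → Subset n → ℕ → Set
TraceHasChain {n} lo F X r =
  Σ (ℕ → Subset n) λ c →
    (∀ i → lo ≤ i → i ≤ r → ∣ c i ∣ ≡ i × InTrace F X (c i))
    × (∀ i → lo ≤ i → i < r → c i ⊆ c (suc i))
    × c r ≡ X

GoodFamily : (lo n k r : ℕ) → List (Subset n) → Set
GoodFamily lo n k r F =
  Unique F × All (λ A → ∣ A ∣ ≡ k) F
  × (∀ (X : Subset n) → ∣ X ∣ ≡ r → ¬ TraceHasChain lo F X r)

IsMaxSize : (lo n k r : ℕ) → ℕ → Set
IsMaxSize lo n k r m =
  (∃[ F ] (GoodFamily lo n k r F × length F ≡ m))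
  × (∀ F → GoodFamily lo n k r F → length F ≤ m)

IsW : (n k r m : ℕ) → Set
IsW = IsMaxSize 0

IsU : (n k r m : ℕ) → Set
IsU = IsMaxSize 1

-- Fix an extremal family F for U(n,k,r).  For a point x, the link
-- F_x = {A ∖ {x} : x ∈ A ∈ F} is a (k-1)-uniform family on [n] ∖ {x} ≅ [n-1], and a
-- maximal chain in the trace of F_x on an (r-1)-set Y becomes, after adding x to
-- every member, an almost maximal chain in the trace of F on Y ∪ {x}.  Hence
-- |F_x| ≤ W(n-1,k-1,r-1) for every x, and double counting the pairs (x, A) with
-- x ∈ A ∈ F gives k |F| = Σₓ |F_x| ≤ n W(n-1,k-1,r-1).
module Submission where

open import Defs
open import Data.Nat using (ℕ; zero; suc; _+_; _*_; _∸_; _≤_; _<_; z≤n; s≤s)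
open import Data.Nat.Properties using (module ≤-Reasoning; +-mono-≤; suc-injective; *-suc; *-zeroʳ; +-0-commutativeMonoid)
open import Data.Bool using (Bool; true; false; _∧_)
open import Data.Fin using (Fin; zero; suc)
open import Data.Fin.Subset using (Subset; inside; outside; ∣_∣; _∩_; _⊆_; _∈_)
open import Data.Fin.Subset.Properties using (_∈?_; drop-∷-⊆)
open import Data.Vec using ([]; _∷_; insertAt; removeAt; here; there)
open import Data.Vec.Properties using (insertAt-removeAt; []=⇒lookup)
open import Data.List using (List; []; _∷_; length; map; filter)
open import Data.List.Properties using (length-map)
open import Data.List.Relation.Unary.All as All using (All; []; _∷_)
open import Data.List.Relation.Unary.All.Properties using (all-filter; map⁺; filter⁺)
open import Data.List.Relation.Unary.AllPairs using ([]; _∷_)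
open import Data.List.Relation.Unary.Unique.Propositional using (Unique)
import Data.List.Relation.Unary.Unique.Propositional.Properties as Unique
open import Data.List.Membership.Propositional using () renaming (_∈_ to _∈ₗ_)
open import Data.List.Membership.Propositional.Properties using (∈-map⁻; ∈-filter⁻)
open import Data.Product using (_×_; ∃-syntax; _,_; proj₁; proj₂)
open import Function using (_∘_)
open import Relation.Binary.PropositionalEquality using (_≡_; refl; sym; trans; cong; cong₂; subst; module ≡-Reasoning)
open import Relation.Nullary using (Dec; does)
open import Algebra.Properties.CommutativeMonoid.Sum +-0-commutativeMonoid using (sum; sum-cong-≗; sum-replicate-zero; ∑-distrib-+)

∣insertAt-inside∣ : ∀ {n} (p : Subset n) (i : Fin (suc n)) → ∣ insertAt p i inside ∣ ≡ suc ∣ p ∣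
∣insertAt-inside∣ p             zero    = refl
∣insertAt-inside∣ (inside ∷ p)  (suc i) = cong suc (∣insertAt-inside∣ p i)
∣insertAt-inside∣ (outside ∷ p) (suc i) = ∣insertAt-inside∣ p i

insertAt-∩ : ∀ {n} (p q : Subset n) (i : Fin (suc n)) a b →
             insertAt p i a ∩ insertAt q i b ≡ insertAt (p ∩ q) i (a ∧ b)
insertAt-∩ p       q       zero    a b = refl
insertAt-∩ (x ∷ p) (y ∷ q) (suc i) a b = cong ((x ∧ y) ∷_) (insertAt-∩ p q i a b)

insertAt-mono-⊆ : ∀ {n} {p q : Subset n} (i : Fin (suc n)) b → p ⊆ q → insertAt p i b ⊆ insertAt q i b
insertAt-mono-⊆ zero b p⊆q here = here
insertAt-mono-⊆ zero b p⊆q (there j∈p) = there (p⊆q j∈p)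
insertAt-mono-⊆ {p = inside ∷ _} {_ ∷ _} (suc i) b p⊆q here with p⊆q here
... | here = here
insertAt-mono-⊆ {p = _ ∷ _} {_ ∷ _} (suc i) b p⊆q (there j∈p) =
  there (insertAt-mono-⊆ i b (drop-∷-⊆ p⊆q) j∈p)

insertAt-removeAt-inside : ∀ {n} {p : Subset (suc n)} {i} → i ∈ p → insertAt (removeAt p i) i inside ≡ p
insertAt-removeAt-inside {p = p} {i} i∈p =
  subst (λ b → insertAt (removeAt p i) i b ≡ p) ([]=⇒lookup i∈p) (insertAt-removeAt p i)

∣removeAt-inside∣ : ∀ {n} {p : Subset (suc n)} {i} → i ∈ p → ∣ p ∣ ≡ suc ∣ removeAt p i ∣
∣removeAt-inside∣ {p = p} {i} i∈p =
  trans (cong ∣_∣ (sym (insertAt-removeAt-inside i∈p))) (∣insertAt-inside∣ (removeAt p i) i)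

removeAt-injective-inside : ∀ {n} {p q : Subset (suc n)} {i} → i ∈ p → i ∈ q →
                            removeAt p i ≡ removeAt q i → p ≡ q
removeAt-injective-inside {p = p} {q} {i} i∈p i∈q eq = begin
  p                                ≡⟨ sym (insertAt-removeAt-inside i∈p) ⟩
  insertAt (removeAt p i) i inside ≡⟨ cong (λ s → insertAt s i inside) eq ⟩
  insertAt (removeAt q i) i inside ≡⟨ insertAt-removeAt-inside i∈q ⟩
  q                                ∎
  where open ≡-Reasoning

map⁺-injectiveOn : ∀ {A B : Set} {P : A → Set} {f : A → B} {xs : List A} →
                   (∀ {a b} → P a → P b → f a ≡ f b → a ≡ b) →
                   All P xs → Unique xs → Unique (map f xs)
map⁺-injectiveOn f-inj []         []         = []
map⁺-injectiveOn f-inj (pa ∷ pxs) (a∉ ∷ uxs) =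
  map⁺ (All.zipWith (λ (a≢b , pb) → a≢b ∘ f-inj pa pb) (a∉ , pxs))
  ∷ map⁺-injectiveOn f-inj pxs uxs

indicator : Bool → ℕ
indicator true  = 1
indicator false = 0

length-filter-∷ : ∀ {A : Set} {P : A → Set} (P? : ∀ a → Dec (P a)) a (xs : List A) →
                  length (filter P? (a ∷ xs)) ≡ indicator (does (P? a)) + length (filter P? xs)
length-filter-∷ P? a xs with does (P? a)
... | true  = refl
... | false = refl

∑-indicator-∈ : ∀ {n} (p : Subset n) → sum (λ x → indicator (does (x ∈? p))) ≡ ∣ p ∣
∑-indicator-∈ []            = refl
∑-indicator-∈ (inside ∷ p)  = cong suc (∑-indicator-∈ p)
∑-indicator-∈ (outside ∷ p) = ∑-indicator-∈ p

∑-bounded : ∀ {n} (f : Fin n → ℕ) {c} → (∀ i → f i ≤ c) → sum f ≤ n * c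
∑-bounded {zero}  f f≤c = z≤n
∑-bounded {suc n} f f≤c = +-mono-≤ (f≤c zero) (∑-bounded (f ∘ suc) (f≤c ∘ suc))

link : ∀ {n} → Fin (suc n) → List (Subset (suc n)) → List (Subset n)
link x F = map (λ A → removeAt A x) (filter (x ∈?_) F)

∈-link⁻ : ∀ {n} {x : Fin (suc n)} {F A′} → A′ ∈ₗ link x F →
          ∃[ A ] (A ∈ₗ F × x ∈ A × removeAt A x ≡ A′)
∈-link⁻ {x = x} A′∈ with ∈-map⁻ (λ A → removeAt A x) A′∈
... | A , A∈ , refl with ∈-filter⁻ (x ∈?_) A∈
...   | A∈F , x∈A = A , A∈F , x∈A , refl

link-unique : ∀ {n} (x : Fin (suc n)) {F} → Unique F → Unique (link x F)
link-unique x {F} uF =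
  map⁺-injectiveOn removeAt-injective-inside (all-filter (x ∈?_) F) (Unique.filter⁺ (x ∈?_) uF)

link-uniform : ∀ {n k} (x : Fin (suc n)) {F} → All (λ A → ∣ A ∣ ≡ suc k) F →
               All (λ A → ∣ A ∣ ≡ k) (link x F)
link-uniform {k = k} x {F} |F|≡ = map⁺ (All.zipWith shrink (all-filter (x ∈?_) F , filter⁺ (x ∈?_) |F|≡))
  where
  shrink : ∀ {A} → x ∈ A × ∣ A ∣ ≡ suc k → ∣ removeAt A x ∣ ≡ k
  shrink (x∈A , |A|≡) = suc-injective (trans (sym (∣removeAt-inside∣ x∈A)) |A|≡)

∑-length-filter-∈ : ∀ {n} k (F : List (Subset n)) → All (λ A → ∣ A ∣ ≡ k) F →
                    sum (λ x → length (filter (x ∈?_) F)) ≡ k * length F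
∑-length-filter-∈ {n} k []      []            = trans (sum-replicate-zero n) (sym (*-zeroʳ k))
∑-length-filter-∈ {n} k (A ∷ F) (|A|≡ ∷ |F|≡) = begin
  sum (λ x → length (filter (x ∈?_) (A ∷ F)))
    ≡⟨ sum-cong-≗ (λ x → length-filter-∷ (x ∈?_) A F) ⟩
  sum (λ x → indicator (does (x ∈? A)) + length (filter (x ∈?_) F))
    ≡⟨ ∑-distrib-+ (λ x → indicator (does (x ∈? A))) (λ x → length (filter (x ∈?_) F)) ⟩
  sum (λ x → indicator (does (x ∈? A))) + sum (λ x → length (filter (x ∈?_) F))
    ≡⟨ cong₂ _+_ (trans (∑-indicator-∈ A) |A|≡) (∑-length-filter-∈ k F |F|≡) ⟩
  k + k * length F
    ≡⟨ sym (*-suc k (length F)) ⟩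
  k * suc (length F) ∎
  where open ≡-Reasoning

∑-length-link : ∀ {n} k (F : List (Subset (suc n))) → All (λ A → ∣ A ∣ ≡ k) F →
                sum (λ x → length (link x F)) ≡ k * length F
∑-length-link k F |F|≡ =
  trans (sum-cong-≗ (λ x → length-map (λ A → removeAt A x) (filter (x ∈?_) F)))
        (∑-length-filter-∈ k F |F|≡)

InTrace-link : ∀ {n} {x : Fin (suc n)} {F Y Z} → InTrace (link x F) Y Z →
               InTrace F (insertAt Y x inside) (insertAt Z x inside)
InTrace-link {x = x} {Y = Y} {Z} (A′ , A′∈ , A′∩Y≡Z) with ∈-link⁻ A′∈
... | A , A∈F , x∈A , refl = A , A∈F , (begin
  A ∩ insertAt Y x inside
    ≡⟨ cong (_∩ insertAt Y x inside) (sym (insertAt-removeAt-inside x∈A)) ⟩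
  insertAt (removeAt A x) x inside ∩ insertAt Y x inside
    ≡⟨ insertAt-∩ (removeAt A x) Y x inside inside ⟩
  insertAt (removeAt A x ∩ Y) x inside
    ≡⟨ cong (λ S → insertAt S x inside) A′∩Y≡Z ⟩
  insertAt Z x inside ∎)
  where open ≡-Reasoning

TraceHasChain-link : ∀ {n} {x : Fin (suc n)} {F Y r} → TraceHasChain 0 (link x F) Y r →
                     TraceHasChain 1 F (insertAt Y x inside) (suc r)
TraceHasChain-link {x = x} {F} {Y} {r} (c , level , step , top) =
  c′ , level′ , step′ , cong (λ S → insertAt S x inside) top
  where
  c′ : ℕ → Subset _
  c′ i = insertAt (c (i ∸ 1)) x inside
  level′ : ∀ i → 1 ≤ i → i ≤ suc r → ∣ c′ i ∣ ≡ i × InTrace F (insertAt Y x inside) (c′ i)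
  level′ (suc i) _ (s≤s i≤r) with level i z≤n i≤r
  ... | |cᵢ|≡i , cᵢ∈ = trans (∣insertAt-inside∣ (c i) x) (cong suc |cᵢ|≡i) , InTrace-link cᵢ∈
  step′ : ∀ i → 1 ≤ i → i < suc r → c′ i ⊆ c′ (suc i)
  step′ (suc i) _ (s≤s i<r) = insertAt-mono-⊆ x inside (step i z≤n i<r)

link-good : ∀ {n k r} (x : Fin (suc n)) {F} →
            GoodFamily 1 (suc n) (suc k) (suc r) F → GoodFamily 0 n k r (link x F)
link-good x (uF , |F|≡ , noChain) =
  link-unique x uF , link-uniform x |F|≡ ,
  λ Y |Y|≡r chain → noChain (insertAt Y x inside)
                            (trans (∣insertAt-inside∣ Y x) (cong suc |Y|≡r))
                            (TraceHasChain-link chain)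

lemma1 : (n k r u w : ℕ) → 2 ≤ k → k ≤ n → 2 ≤ r
    → IsU n k r u → IsW (n ∸ 1) (k ∸ 1) (r ∸ 1) w
    → k * u ≤ n * w
lemma1 (suc n) (suc k) (suc r) u w (s≤s _) (s≤s _) (s≤s _) ((F , goodF , refl) , _) (_ , W-max) = begin
  suc k * length F                      ≡⟨ sym (∑-length-link (suc k) F (proj₁ (proj₂ goodF))) ⟩
  sum (λ x → length (link x F))         ≤⟨ ∑-bounded _ (λ x → W-max (link x F) (link-good x goodF)) ⟩
  suc n * w                             ∎
  where open ≤-Reasoning
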